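{- Let $G$ be an $\mathrm{AT}$-free graph. Then for any four vertices $u,v,x,y$ of $G$: if $u\in I(v,x)$ and $v\in I(u,y)$, then $u\in I(x,y)$.
   Context: Graphs are finite and simple. For a vertex $x$, $N(x)$ is its neighborhood and $N[x]=N(x)\cup\{x\}$. An asteroidal triple is a set of three vertices such that every pair of them is connected by a path avoiding the closed neighborhood $N[\cdot]$ of the third; a graph is $\mathrm{AT}$-free if it has no asteroidal triple. For vertices $x,y$, a vertex $z$ is between $x$ and $y$ if there is a path from $z$ to $x$ all of whose vertices avoid $N[y]$ and a path from $z$ to $y$ all of whose vertices avoid $N[x]$; $I(x,y)$ denotes the set of vertices between $x$ and $y$. -}

module Defs where

open import Level using (Level; 0ℓ; suc)
open import Data.Nat using (ℕ)
open import Data.Fin using (Fin)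
open import Data.Product using (_×_)
open import Data.Sum using (_⊎_)
open import Relation.Nullary using (¬_)
open import Relation.Binary.PropositionalEquality using (_≡_)

record Graph (n : ℕ) : Set₁ where
  field
    Adj   : Fin n → Fin n → Set
    irrefl : ∀ {x} → ¬ Adj x x
    sym   : ∀ {x y} → Adj x y → Adj y x
open Graph public

module _ {n : ℕ} (G : Graph n) where

  InClosedNbhd : Fin n → Fin n → Set
  InClosedNbhd x v = (v ≡ x) ⊎ Adj G x v

  data PathAvoiding (w : Fin n) : Fin n → Fin n → Set where
    here  : ∀ {a} → ¬ InClosedNbhd w a → PathAvoiding w a a
    there : ∀ {a c b} → ¬ InClosedNbhd w a → Adj G a c →
            PathAvoiding w c b → PathAvoiding w a b

  AsteroidalTriple : Fin n → Fin n → Fin n → Set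
  AsteroidalTriple a b c =
    ¬ (a ≡ b) × ¬ (b ≡ c) × ¬ (a ≡ c) ×
    PathAvoiding c a b × PathAvoiding a b c × PathAvoiding b a c

  ATFree : Set
  ATFree = ∀ a b c → ¬ AsteroidalTriple a b c

  Between : Fin n → Fin n → Fin n → Set
  Between z x y = PathAvoiding y z x × PathAvoiding x z y

-- If P4 (from v to y, avoiding N[u]) met N[x], its prefix would give a path from v to x
-- avoiding N[u], and with P1, P2 from the hypotheses {u, v, x} would be an asteroidal
-- triple; so P1 followed by P4 avoids N[x]. Symmetrically, if the path from u to x avoiding
-- N[v] met N[y], then {u, v, y} would be an asteroidal triple.
module Submission where

open import Defs
open import Data.Nat using (ℕ)
open import Data.Fin using (Fin)
open import Data.Product using (_,_)
open import Data.Sum using (inj₁; inj₂)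
open import Relation.Nullary using (¬_)
open import Relation.Binary.PropositionalEquality using (_≡_; refl)

module _ {n : ℕ} (G : Graph n) where

  private
    Path = PathAvoiding G
    N[_]∋_ = InClosedNbhd G

  ∉N[]-sym : ∀ {a b} → ¬ N[ a ]∋ b → ¬ N[ b ]∋ a
  ∉N[]-sym a∌b (inj₁ refl) = a∌b (inj₁ refl)
  ∉N[]-sym a∌b (inj₂ b~a)  = a∌b (inj₂ (sym G b~a))

  ∉N[]⇒≢ : ∀ {a b} → ¬ N[ a ]∋ b → ¬ b ≡ a
  ∉N[]⇒≢ a∌b b≡a = a∌b (inj₁ b≡a)

  source-∉N[] : ∀ {w a b} → Path w a b → ¬ N[ w ]∋ a
  source-∉N[] (here w∌a)      = w∌a
  source-∉N[] (there w∌a _ _) = w∌a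

  target-∉N[] : ∀ {w a b} → Path w a b → ¬ N[ w ]∋ b
  target-∉N[] (here w∌b)    = w∌b
  target-∉N[] (there _ _ p) = target-∉N[] p

  _∷ʳ_ : ∀ {w a b c} → Path w a b → Adj G b c → ¬ N[ w ]∋ c → Path w a c
  (here w∌a        ∷ʳ b~c) w∌c = there w∌a b~c (here w∌c)
  (there w∌a a~d p ∷ʳ b~c) w∌c = there w∌a a~d ((p ∷ʳ b~c) w∌c)

  _++_ : ∀ {w a b c} → Path w a b → Path w b c → Path w a c
  here _          ++ q = q
  there w∌a a~d p ++ q = there w∌a a~d (p ++ q)

  reverse : ∀ {w a b} → Path w a b → Path w b a
  reverse (here w∌a)        = here w∌a
  reverse (there w∌a a~c p) = (reverse p ∷ʳ sym G a~c) w∌a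

  reach-via-N[] : ∀ {w w' a c} → ¬ N[ w ]∋ w' → Path w a c → N[ w' ]∋ c → Path w a w'
  reach-via-N[] _    p (inj₁ refl) = p
  reach-via-N[] w∌w' p (inj₂ w'~c) = (p ∷ʳ sym G w'~c) w∌w'

  avoids-unreachable : ∀ {w w' a b} → ¬ N[ w ]∋ w' → ¬ Path w a w' →
                       Path w a b → Path w' a b
  avoids-unreachable w∌w' unreachable (here w∌a) =
    here (λ w'∋a → unreachable (reach-via-N[] w∌w' (here w∌a) w'∋a))
  avoids-unreachable w∌w' unreachable (there w∌a a~c p) =
    there (λ w'∋a → unreachable (reach-via-N[] w∌w' (here w∌a) w'∋a)) a~c
          (avoids-unreachable w∌w' (λ q → unreachable (there w∌a a~c q)) p)

  ATFree⇒¬third-path : ATFree G → ∀ {a b c} →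
                       Path c a b → Path a b c → ¬ Path b a c
  ATFree⇒¬third-path atFree p q r =
    atFree _ _ _ ( ∉N[]⇒≢ (∉N[]-sym (source-∉N[] q)) , ∉N[]⇒≢ (target-∉N[] p)
                 , ∉N[]⇒≢ (source-∉N[] p) , p , q , r )

lemma2p3 : (n : ℕ) (G : Graph n) → ATFree G →
    (u v x y : Fin n) →
    Between G u v x → Between G v u y → Between G u x y
lemma2p3 n G atFree u v x y (u→v∌x , u→x∌v) (v→u∌y , v→y∌u) = u→x∌y , u→y∌x
  where
    u→x∌y : PathAvoiding G y u x
    u→x∌y = avoids-unreachable G (∉N[]-sym G (source-∉N[] G v→u∌y))
              (ATFree⇒¬third-path G atFree (reverse G v→u∌y) v→y∌u) u→x∌v

    u→y∌x : PathAvoiding G x u y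
    u→y∌x = _++_ G u→v∌x
              (avoids-unreachable G (∉N[]-sym G (source-∉N[] G u→v∌x))
                 (ATFree⇒¬third-path G atFree (reverse G u→v∌x) u→x∌v) v→y∌u)
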